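{- For every integer $n \geq 3$, the number of permutations $\pi$ of $\{1,2,\dots,n\}$ which contain exactly one occurrence of the pattern $132$ and no occurrence of the pattern $123$ equals $(n-2)2^{n-3}$.
   Context: A permutation $\pi$ of $\{1,\dots,n\}$ is written as the sequence $\pi(1)\pi(2)\cdots\pi(n)$. An occurrence of the pattern $123$ in $\pi$ is a triple of indices $i<j<k$ with $\pi(i)<\pi(j)<\pi(k)$. An occurrence of the pattern $132$ in $\pi$ is a triple of indices $i<j<k$ with $\pi(i)<\pi(k)<\pi(j)$. A permutation avoids a pattern if it has no occurrence of it. -}

module Defs where

open import Data.Nat using (ℕ; zero; suc)
open import Data.Fin using (Fin; _<_; _<?_)
open import Data.Fin.Properties using (_≟_; all?)
open import Data.Vec using (Vec; []; _∷_; lookup)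
open import Data.List using (List; []; _∷_; map; concatMap; filter; length; allFin)
open import Data.Product using (_×_; _,_; Σ)
open import Relation.Binary.PropositionalEquality using (_≡_)
open import Relation.Nullary using (Dec; yes; no; ¬_)
open import Relation.Nullary.Decidable using (_×-dec_; _→-dec_; ¬?)
open import Relation.Unary using (Decidable)

allWords : (n m : ℕ) → List (Vec (Fin m) n)
allWords zero    m = [] ∷ []
allWords (suc n) m = concatMap (λ x → map (x ∷_) (allWords n m)) (allFin m)

-- A word of length n over Fin n is a permutation of {1..n} (0-indexed here)
-- iff it is injective (the one-line notation π(1)π(2)...π(n)).
IsPerm : ∀ {n} → Vec (Fin n) n → Set
IsPerm {n} w = ∀ (i j : Fin n) → lookup w i ≡ lookup w j → i ≡ j

isPerm? : ∀ {n} (w : Vec (Fin n) n) → Dec (IsPerm w)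
isPerm? w = all? (λ i → all? (λ j → (lookup w i ≟ lookup w j) →-dec (i ≟ j)))

triples : (n : ℕ) → List (Fin n × Fin n × Fin n)
triples n = concatMap (λ i → concatMap (λ j → map (λ k → (i , j , k)) (allFin n)) (allFin n)) (allFin n)

Occ123 : ∀ {n m} → Vec (Fin m) n → Fin n × Fin n × Fin n → Set
Occ123 w (i , j , k) = i < j × j < k × lookup w i < lookup w j × lookup w j < lookup w k

occ123? : ∀ {n m} (w : Vec (Fin m) n) → Decidable (Occ123 w)
occ123? w (i , j , k) = (i <? j) ×-dec (j <? k) ×-dec (lookup w i <? lookup w j) ×-dec (lookup w j <? lookup w k)

Occ132 : ∀ {n m} → Vec (Fin m) n → Fin n × Fin n × Fin n → Set
Occ132 w (i , j , k) = i < j × j < k × lookup w i < lookup w k × lookup w k < lookup w j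

occ132? : ∀ {n m} (w : Vec (Fin m) n) → Decidable (Occ132 w)
occ132? w (i , j , k) = (i <? j) ×-dec (j <? k) ×-dec (lookup w i <? lookup w k) ×-dec (lookup w k <? lookup w j)

#123 : ∀ {n m} → Vec (Fin m) n → ℕ
#123 {n} w = length (filter (occ123? w) (triples n))

#132 : ∀ {n m} → Vec (Fin m) n → ℕ
#132 {n} w = length (filter (occ132? w) (triples n))

Good : ∀ {n} → Vec (Fin n) n → Set
Good w = IsPerm w × #132 w ≡ 1 × #123 w ≡ 0

good? : ∀ {n} (w : Vec (Fin n) n) → Dec (Good w)
good? w = isPerm? w ×-dec (Data.Nat._≟_ (#132 w) 1) ×-dec (Data.Nat._≟_ (#123 w) 0)
  where import Data.Nat

count : ℕ → ℕ
count n = length (filter good? (allWords n n))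

-- Write a permutation of size n + 1 as its first letter x followed by the permutation v
-- order-isomorphic to the remaining letters (prepend x v).  An occurrence of 132 or 123 either
-- lies in v or is "leading": it starts at x and uses two letters larger than x.  Any two letters
-- larger than x form a leading 123 or a leading 132 with x, and any three form a leading 123 or
-- two leading 132's.  Hence a permutation avoiding both patterns starts with one of its two
-- largest letters, so there are 2^(n-1) of size n; and a permutation with one 132 and no 123
-- starts with one of its three largest letters.  After the largest or the second largest the
-- rest is again such a permutation; after the third largest the rest avoids both patterns and
-- starts with its maximum.  So c(n + 1) = 2 c(n) + 2^(n-2) with c(2) = 0.

module Submission where

open import Defs
open import Data.Nat using (ℕ; _≤_; _*_; _∸_; _^_)
open import Relation.Binary.PropositionalEquality using (_≡_)

open import Data.Bool using (true; false; if_then_else_)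
open import Data.Fin as Fin using (Fin; zero; suc; toℕ; punchIn; punchOut; fromℕ; opposite)
import Data.Fin.Properties as Finₚ
open import Data.Fin.Patterns using (0F; 1F; 2F)
open import Data.Fin.Permutation using (reverse)
open import Data.List using (List; []; _∷_; _++_; length; filter; map; concatMap; tabulate; allFin)
import Data.List.Properties as Listₚ
open import Data.Nat using (zero; suc; _+_; _<_; z≤n; s≤s; z<s; s<s; s≤s⁻¹; s<s⁻¹)
import Data.Nat.Properties as ℕ
open import Data.Nat.Tactic.RingSolver using (solve-∀)
open import Algebra.Properties.CommutativeMonoid.Sum ℕ.+-0-commutativeMonoid
  using (sum; sum-remove; sum-cong-≗; sum-replicate-zero; sum-permute)
open import Data.Product using (_×_; _,_; proj₁; proj₂; ∃; swap)
open import Data.Product.Function.NonDependent.Propositional using (_×-⇔_)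
open import Data.Vec using (Vec; []; _∷_; lookup)
import Data.Vec as Vec
open import Data.Vec.Properties using (lookup-map)
open import Function using (id; _∘_; _⇔_; mk⇔; Equivalence)
import Function.Properties.Equivalence as ⇔
open import Level using (0ℓ)
open import Relation.Binary.Definitions using (tri<; tri≈; tri>) renaming (Decidable to Decidable₂)
open import Relation.Binary.PropositionalEquality
  using (refl; sym; trans; cong; cong₂; subst; subst₂; _≢_; module ≡-Reasoning)
open import Relation.Nullary using (Dec; yes; no; does; ¬_; contradiction)
open import Relation.Nullary.Decidable using (_×-dec_)
open import Relation.Unary using (Pred; Decidable)

open Equivalence using (to; from)

-- Finite sums

𝟙 : {A : Set} → Dec A → ℕ
𝟙 d = if does d then 1 else 0

𝟙-yes : {A : Set} (d : Dec A) → A → 𝟙 d ≡ 1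
𝟙-yes (yes _) _ = refl
𝟙-yes (no ¬a) a = contradiction a ¬a

𝟙-no : {A : Set} (d : Dec A) → ¬ A → 𝟙 d ≡ 0
𝟙-no (yes a) ¬a = contradiction a ¬a
𝟙-no (no _)  _  = refl

𝟙-cong : {A B : Set} (a : Dec A) (b : Dec B) → A ⇔ B → 𝟙 a ≡ 𝟙 b
𝟙-cong (yes _) (yes _) _   = refl
𝟙-cong (no _)  (no _)  _   = refl
𝟙-cong (yes a) (no ¬b) A⇔B = contradiction (to A⇔B a) ¬b
𝟙-cong (no ¬a) (yes b) A⇔B = contradiction (from A⇔B b) ¬a

sum-zero : ∀ {n} (f : Fin n → ℕ) → (∀ i → f i ≡ 0) → sum f ≡ 0
sum-zero {n} f f≗0 = trans (sum-cong-≗ f≗0) (sum-replicate-zero n)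

term≤sum : ∀ {n} (f : Fin n → ℕ) i → f i ≤ sum f
term≤sum {suc n} f i = ℕ.≤-trans (ℕ.m≤m+n (f i) _) (ℕ.≤-reflexive (sym (sum-remove {i = i} f)))

two-terms≤sum : ∀ {n} (f : Fin n → ℕ) {i j} → i ≢ j → f i + f j ≤ sum f
two-terms≤sum {suc n} f {i} {j} i≢j = begin
  f i + f j                           ≡⟨ cong (λ k → f i + f k) (Finₚ.punchIn-punchOut i≢j) ⟨
  f i + f (punchIn i (punchOut i≢j))  ≤⟨ ℕ.+-monoʳ-≤ (f i) (term≤sum (f ∘ punchIn i) (punchOut i≢j)) ⟩
  f i + sum (f ∘ punchIn i)           ≡⟨ sum-remove {i = i} f ⟨
  sum f                               ∎
  where open ℕ.≤-Reasoning

sum-single : ∀ {n} (f : Fin n → ℕ) i → (∀ j → j ≢ i → f j ≡ 0) → sum f ≡ f i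
sum-single {suc n} f i f≡0 = begin
  sum f                      ≡⟨ sum-remove {i = i} f ⟩
  f i + sum (f ∘ punchIn i)  ≡⟨ cong (f i +_) (sum-zero _ (λ j → f≡0 _ (Finₚ.punchInᵢ≢i i j))) ⟩
  f i + 0                    ≡⟨ ℕ.+-identityʳ (f i) ⟩
  f i                        ∎
  where open ≡-Reasoning

sum-opposite : ∀ {n} (f : Fin n → ℕ) → sum f ≡ sum (f ∘ opposite)
sum-opposite f = sum-permute f reverse

module _ {n} {P : Fin n → Fin n → Set} (P? : Decidable₂ P) where

  #pairs : ℕ
  #pairs = sum λ j → sum λ k → 𝟙 (P? j k)

  #pairs≡0 : (∀ j k → ¬ P j k) → #pairs ≡ 0
  #pairs≡0 ¬P = sum-zero _ λ j → sum-zero _ λ k → 𝟙-no (P? j k) (¬P j k)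

  1≤#pairs : ∀ {j k} → P j k → 1 ≤ #pairs
  1≤#pairs {j} {k} p = begin
    1                         ≡⟨ 𝟙-yes (P? j k) p ⟨
    𝟙 (P? j k)                ≤⟨ term≤sum _ k ⟩
    sum (λ k → 𝟙 (P? j k))    ≤⟨ term≤sum _ j ⟩
    #pairs                    ∎
    where open ℕ.≤-Reasoning

  2≤#pairs : ∀ {j k k′} → P j k → P j k′ → k ≢ k′ → 2 ≤ #pairs
  2≤#pairs {j} {k} {k′} p p′ k≢k′ = begin
    2                          ≡⟨ cong₂ _+_ (𝟙-yes (P? j k) p) (𝟙-yes (P? j k′) p′) ⟨
    𝟙 (P? j k) + 𝟙 (P? j k′)   ≤⟨ two-terms≤sum _ k≢k′ ⟩
    sum (λ k → 𝟙 (P? j k))     ≤⟨ term≤sum _ j ⟩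
    #pairs                     ∎
    where open ℕ.≤-Reasoning

  #pairs≡1 : ∀ {j k} → P j k → (∀ {j′ k′} → P j′ k′ → j′ ≡ j × k′ ≡ k) → #pairs ≡ 1
  #pairs≡1 {j} {k} p unique = begin
    #pairs
      ≡⟨ sum-single _ j (λ j′ j′≢j → sum-zero _ λ k′ → 𝟙-no (P? j′ k′) (j′≢j ∘ proj₁ ∘ unique)) ⟩
    sum (λ k′ → 𝟙 (P? j k′))
      ≡⟨ sum-single _ k (λ k′ k′≢k → 𝟙-no (P? j k′) (k′≢k ∘ proj₂ ∘ unique)) ⟩
    𝟙 (P? j k)
      ≡⟨ 𝟙-yes (P? j k) p ⟩
    1 ∎
    where open ≡-Reasoning

-- Counting words

module _ {A : Set} {P : Pred A 0ℓ} (P? : Decidable P) where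

  #filter : List A → ℕ
  #filter xs = length (filter P? xs)

  #filter-∷ : ∀ x xs → #filter (x ∷ xs) ≡ 𝟙 (P? x) + #filter xs
  #filter-∷ x xs with does (P? x)
  ... | true  = refl
  ... | false = refl

  #filter-++ : ∀ xs ys → #filter (xs ++ ys) ≡ #filter xs + #filter ys
  #filter-++ xs ys = trans (cong length (Listₚ.filter-++ P? xs ys)) (Listₚ.length-++ (filter P? xs))

  #filter-tabulate : ∀ {k} (g : Fin k → A) → #filter (tabulate g) ≡ sum (𝟙 ∘ P? ∘ g)
  #filter-tabulate {zero}  g = refl
  #filter-tabulate {suc k} g =
    trans (#filter-∷ (g zero) _) (cong (𝟙 (P? (g zero)) +_) (#filter-tabulate (g ∘ suc)))

  #filter-concatMap : ∀ {B : Set} {k} (g : Fin k → B) (f : B → List A) →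
                      #filter (concatMap f (tabulate g)) ≡ sum (#filter ∘ f ∘ g)
  #filter-concatMap {k = zero}  g f = refl
  #filter-concatMap {k = suc k} g f =
    trans (#filter-++ (f (g zero)) _) (cong (#filter (f (g zero)) +_) (#filter-concatMap (g ∘ suc) f))

  #filter-none : ∀ xs → (∀ x → ¬ P x) → #filter xs ≡ 0
  #filter-none []       ¬P = refl
  #filter-none (x ∷ xs) ¬P = trans (#filter-∷ x xs) (cong₂ _+_ (𝟙-no (P? x) (¬P x)) (#filter-none xs ¬P))

#filter-map : ∀ {A B : Set} {P : Pred B 0ℓ} (P? : Decidable P) (f : A → B) xs →
              #filter P? (map f xs) ≡ #filter (P? ∘ f) xs
#filter-map P? f []       = refl
#filter-map P? f (x ∷ xs) = trans (#filter-∷ P? (f x) _)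
  (trans (cong (𝟙 (P? (f x)) +_) (#filter-map P? f xs)) (sym (#filter-∷ (P? ∘ f) x xs)))

#filter-cong : ∀ {A : Set} {P Q : Pred A 0ℓ} (P? : Decidable P) (Q? : Decidable Q) xs →
               (∀ x → P x ⇔ Q x) → #filter P? xs ≡ #filter Q? xs
#filter-cong P? Q? []       P⇔Q = refl
#filter-cong P? Q? (x ∷ xs) P⇔Q = trans (#filter-∷ P? x xs)
  (trans (cong₂ _+_ (𝟙-cong (P? x) (Q? x) (P⇔Q x)) (#filter-cong P? Q? xs P⇔Q)) (sym (#filter-∷ Q? x xs)))

#words : ∀ {m} k {P : Pred (Vec (Fin m) k) 0ℓ} → Decidable P → ℕ
#words {m} k P? = #filter P? (allWords k m)

#words-∷ : ∀ {m} k {P : Pred (Vec (Fin m) (suc k)) 0ℓ} (P? : Decidable P) →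
           #words (suc k) P? ≡ sum λ x → #words k (λ u → P? (x ∷ u))
#words-∷ {m} k P? = trans (#filter-concatMap P? id (λ x → map (x ∷_) (allWords k m)))
  (sum-cong-≗ λ x → #filter-map P? (x ∷_) (allWords k m))

#words-cong : ∀ {m} k {P Q : Pred (Vec (Fin m) k) 0ℓ} (P? : Decidable P) (Q? : Decidable Q) →
              (∀ w → P w ⇔ Q w) → #words k P? ≡ #words k Q?
#words-cong {m} k P? Q? = #filter-cong P? Q? (allWords k m)

#words-none : ∀ {m} k {P : Pred (Vec (Fin m) k) 0ℓ} (P? : Decidable P) → (∀ w → ¬ P w) → #words k P? ≡ 0
#words-none {m} k P? = #filter-none P? (allWords k m)

#words-without : ∀ {m} k (x : Fin (suc m)) {P : Pred (Vec (Fin (suc m)) k) 0ℓ} (P? : Decidable P) →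
                 (∀ w → P w → ∀ i → lookup w i ≢ x) → #words k P? ≡ #words k (P? ∘ Vec.map (punchIn x))
#words-without zero    x P? _      = trans (#filter-∷ P? [] []) (sym (#filter-∷ (P? ∘ Vec.map (punchIn x)) [] []))
#words-without (suc k) x P? misses = begin
  #words (suc k) P?
    ≡⟨ #words-∷ k P? ⟩
  sum (λ y → #words k (λ u → P? (y ∷ u)))
    ≡⟨ sum-remove {i = x} (λ y → #words k (λ u → P? (y ∷ u))) ⟩
  #words k (λ u → P? (x ∷ u)) + sum (λ y → #words k (λ u → P? (punchIn x y ∷ u)))
    ≡⟨ cong₂ _+_ (#words-none k (λ u → P? (x ∷ u)) λ u p → misses (x ∷ u) p zero refl)
                 (sum-cong-≗ λ y → #words-without k x (λ u → P? (punchIn x y ∷ u))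
                                     λ u p i → misses _ p (suc i)) ⟩
  sum (λ y → #words k (λ u → P? (punchIn x y ∷ Vec.map (punchIn x) u)))
    ≡⟨ #words-∷ k (P? ∘ Vec.map (punchIn x)) ⟨
  #words (suc k) (P? ∘ Vec.map (punchIn x))
    ∎
  where open ≡-Reasoning

-- Permutations

prepend : ∀ {n} → Fin (suc n) → Vec (Fin n) n → Vec (Fin (suc n)) (suc n)
prepend x v = x ∷ Vec.map (punchIn x) v

isPerm-prepend : ∀ {n} (x : Fin (suc n)) (v : Vec (Fin n) n) → IsPerm (prepend x v) ⇔ IsPerm v
isPerm-prepend x v = mk⇔ tail-isPerm cons-isPerm
  where
  lk : ∀ i → lookup (Vec.map (punchIn x) v) i ≡ punchIn x (lookup v i)
  lk i = lookup-map i (punchIn x) v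

  tail-isPerm : IsPerm (prepend x v) → IsPerm v
  tail-isPerm perm i j eq =
    Finₚ.suc-injective (perm (suc i) (suc j) (trans (lk i) (trans (cong (punchIn x) eq) (sym (lk j)))))

  cons-isPerm : IsPerm v → IsPerm (prepend x v)
  cons-isPerm perm zero    zero    eq = refl
  cons-isPerm perm zero    (suc j) eq = contradiction (sym (trans eq (lk j))) (Finₚ.punchInᵢ≢i x (lookup v j))
  cons-isPerm perm (suc i) zero    eq = contradiction (trans (sym (lk i)) eq) (Finₚ.punchInᵢ≢i x (lookup v i))
  cons-isPerm perm (suc i) (suc j) eq =
    cong suc (perm i j (Finₚ.punchIn-injective x _ _ (trans (sym (lk i)) (trans eq (lk j)))))

#perms-by-first : ∀ n {P : Pred (Vec (Fin (suc n)) (suc n)) 0ℓ} (P? : Decidable P) →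
                  (∀ w → P w → IsPerm w) →
                  #words (suc n) P? ≡ sum λ x → #words n (λ v → P? (prepend x v))
#perms-by-first n P? P⇒perm = trans (#words-∷ n P?) (sum-cong-≗ λ x →
  #words-without n x (λ u → P? (x ∷ u)) λ u p i eq → Finₚ.0≢1+n (sym (P⇒perm _ p (suc i) zero eq)))

isPerm⇒surjective : ∀ {n} (v : Vec (Fin n) n) → IsPerm v → ∀ y → ∃ λ p → lookup v p ≡ y
isPerm⇒surjective {suc n} v perm y with Finₚ.any? (λ p → lookup v p Finₚ.≟ y)
... | yes hit = hit
... | no ¬hit =
  let i , j , i<j , eq = Finₚ.pigeonhole (ℕ.n<1+n n) (λ p → punchOut (miss p))
  in  contradiction (perm i j (Finₚ.punchOut-injective (miss i) (miss j) eq)) (Finₚ.<⇒≢ i<j)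
  where
  miss : ∀ p → y ≢ lookup v p
  miss p eq = ¬hit (p , sym eq)

position : ∀ {n} (v : Vec (Fin n) n) → IsPerm v → ∀ {a} → a < n → ∃ λ p → toℕ (lookup v p) ≡ a
position v perm a<n =
  let p , eq = isPerm⇒surjective v perm (Fin.fromℕ< a<n)
  in  p , trans (cong toℕ eq) (Finₚ.toℕ-fromℕ< a<n)

-- Occurrences of a pattern

ValuePattern : Set₁
ValuePattern = ∀ {m} → Fin m → Fin m → Fin m → Set

Occ : ValuePattern → ∀ {n m} → Vec (Fin m) n → Fin n × Fin n × Fin n → Set
Occ R w (i , j , k) = i Fin.< j × j Fin.< k × R (lookup w i) (lookup w j) (lookup w k)

PunchInInvariant : ValuePattern → Set
PunchInInvariant R = ∀ {m} (x : Fin (suc m)) a b c → R (punchIn x a) (punchIn x b) (punchIn x c) ⇔ R a b c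

module Occurrences {R : ValuePattern} (R? : ∀ {m} (a b c : Fin m) → Dec (R a b c)) where

  occ? : ∀ {n m} (w : Vec (Fin m) n) → Decidable (Occ R w)
  occ? w (i , j , k) = (i Fin.<? j) ×-dec (j Fin.<? k) ×-dec R? (lookup w i) (lookup w j) (lookup w k)

  #occ : ∀ {n m} → Vec (Fin m) n → ℕ
  #occ {n} w = #filter (occ? w) (triples n)

  lead? : ∀ {n m} (w : Vec (Fin m) (suc n)) → Decidable₂ λ j k → Occ R w (zero , suc j , suc k)
  lead? w j k = occ? w (zero , suc j , suc k)

  #lead : ∀ {n m} → Vec (Fin m) (suc n) → ℕ
  #lead w = #pairs (lead? w)

  #occ≡∑ : ∀ {n m} (w : Vec (Fin m) n) →
           #occ w ≡ sum λ i → sum λ j → sum λ k → 𝟙 (occ? w (i , j , k))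
  #occ≡∑ {n} w =
    trans (#filter-concatMap (occ? w) id (λ i → concatMap (λ j → map (λ k → (i , j , k)) (allFin n)) (allFin n)))
      (sum-cong-≗ λ i → trans (#filter-concatMap (occ? w) id (λ j → map (λ k → (i , j , k)) (allFin n)))
        (sum-cong-≗ λ j → trans (cong (#filter (occ? w)) (Listₚ.map-tabulate id (λ k → (i , j , k))))
          (#filter-tabulate (occ? w) (λ k → (i , j , k)))))

  1≤#occ : ∀ {n m} (w : Vec (Fin m) n) {t} → Occ R w t → 1 ≤ #occ w
  1≤#occ w {i , j , k} o = begin
    1                                                  ≡⟨ 𝟙-yes (occ? w (i , j , k)) o ⟨
    𝟙 (occ? w (i , j , k))                             ≤⟨ term≤sum _ k ⟩
    sum (λ k → 𝟙 (occ? w (i , j , k)))                 ≤⟨ term≤sum _ j ⟩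
    sum (λ j → sum λ k → 𝟙 (occ? w (i , j , k)))       ≤⟨ term≤sum _ i ⟩
    sum (λ i → sum λ j → sum λ k → 𝟙 (occ? w (i , j , k))) ≡⟨ #occ≡∑ w ⟨
    #occ w                                             ∎
    where open ℕ.≤-Reasoning

  #occ-∷ : ∀ {n m} (a : Fin m) (u : Vec (Fin m) n) → #occ (a ∷ u) ≡ #lead (a ∷ u) + #occ u
  #occ-∷ a u = begin
    #occ (a ∷ u)
      ≡⟨ #occ≡∑ (a ∷ u) ⟩
    sum (λ i → sum λ j → sum λ k → 𝟙 (occ? (a ∷ u) (i , j , k)))
      ≡⟨ sum-cong-≗ middle-and-last-not-first ⟩
    sum (λ i → sum λ j → sum λ k → 𝟙 (occ? (a ∷ u) (i , suc j , suc k)))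
      ≡⟨ cong (#lead (a ∷ u) +_) (sum-cong-≗ λ i → sum-cong-≗ λ j → sum-cong-≗ λ k →
           𝟙-cong (occ? (a ∷ u) _) (occ? u _) (occ-tail i j k)) ⟩
    #lead (a ∷ u) + sum (λ i → sum λ j → sum λ k → 𝟙 (occ? u (i , j , k)))
      ≡⟨ cong (#lead (a ∷ u) +_) (#occ≡∑ u) ⟨
    #lead (a ∷ u) + #occ u
      ∎
    where
    open ≡-Reasoning
    middle-and-last-not-first : ∀ i → sum (λ j → sum λ k → 𝟙 (occ? (a ∷ u) (i , j , k)))
                                    ≡ sum (λ j → sum λ k → 𝟙 (occ? (a ∷ u) (i , suc j , suc k)))
    middle-and-last-not-first i =
      cong₂ _+_ (sum-zero _ λ k → 𝟙-no (occ? (a ∷ u) (i , zero , k)) λ { (() , _) })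
                (sum-cong-≗ λ j → cong (_+ sum λ k → 𝟙 (occ? (a ∷ u) (i , suc j , suc k)))
                                      (𝟙-no (occ? (a ∷ u) (i , suc j , zero)) λ { (_ , () , _) }))
    occ-tail : ∀ i j k → Occ R (a ∷ u) (suc i , suc j , suc k) ⇔ Occ R u (i , j , k)
    occ-tail i j k = mk⇔ (λ (i<j , j<k , r) → s<s⁻¹ i<j , s<s⁻¹ j<k , r)
                         (λ (i<j , j<k , r) → s<s i<j , s<s j<k , r)

  #occ-map-punchIn : PunchInInvariant R → ∀ {n m} (x : Fin (suc m)) (v : Vec (Fin m) n) →
                     #occ (Vec.map (punchIn x) v) ≡ #occ v
  #occ-map-punchIn invariant x v = trans (#occ≡∑ (Vec.map (punchIn x) v))
    (trans (sum-cong-≗ λ i → sum-cong-≗ λ j → sum-cong-≗ λ k →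
              𝟙-cong (occ? (Vec.map (punchIn x) v) _) (occ? v _) (occ-map i j k))
           (sym (#occ≡∑ v)))
    where
    occ-map : ∀ i j k → Occ R (Vec.map (punchIn x) v) (i , j , k) ⇔ Occ R v (i , j , k)
    occ-map i j k rewrite lookup-map i (punchIn x) v | lookup-map j (punchIn x) v | lookup-map k (punchIn x) v =
      ⇔.refl ×-⇔ ⇔.refl ×-⇔ invariant x _ _ _

-- The patterns 132 and 123

-- Occ R132 and Pattern132.#occ unfold to Occ132 and #132 of Defs (likewise for 123), so the
-- general lemmas about occurrences apply to #132 and #123 as they stand.
R132 : ValuePattern
R132 a b c = a Fin.< c × c Fin.< b

R132? : ∀ {m} (a b c : Fin m) → Dec (R132 a b c)
R132? a b c = (a Fin.<? c) ×-dec (c Fin.<? b)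

R123 : ValuePattern
R123 a b c = a Fin.< b × b Fin.< c

R123? : ∀ {m} (a b c : Fin m) → Dec (R123 a b c)
R123? a b c = (a Fin.<? b) ×-dec (b Fin.<? c)

punchIn-<⇔ : ∀ {m} (x : Fin (suc m)) {a b} → punchIn x a Fin.< punchIn x b ⇔ a Fin.< b
punchIn-<⇔ x {a} {b} = mk⇔
  (λ πa<πb → ℕ.≰⇒> λ b≤a → ℕ.<⇒≱ πa<πb (Finₚ.punchIn-mono-≤ x b a b≤a))
  (λ a<b → ℕ.≰⇒> λ πb≤πa → ℕ.<⇒≱ a<b (Finₚ.punchIn-cancel-≤ x b a πb≤πa))

<punchIn⇔ : ∀ {m} (x : Fin (suc m)) (a : Fin m) → x Fin.< punchIn x a ⇔ toℕ x ≤ toℕ a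
<punchIn⇔ zero    a       = mk⇔ (λ _ → z≤n) (λ _ → z<s)
<punchIn⇔ (suc x) zero    = mk⇔ (λ ()) (λ ())
<punchIn⇔ (suc x) (suc a) = mk⇔ (s≤s ∘ to (<punchIn⇔ x a) ∘ s<s⁻¹)
                                (s<s ∘ from (<punchIn⇔ x a) ∘ s≤s⁻¹)

R132-invariant : PunchInInvariant R132
R132-invariant x _ _ _ = punchIn-<⇔ x ×-⇔ punchIn-<⇔ x

R123-invariant : PunchInInvariant R123
R123-invariant x _ _ _ = punchIn-<⇔ x ×-⇔ punchIn-<⇔ x

module Pattern132 = Occurrences R132?
module Pattern123 = Occurrences R123?

#132-prepend : ∀ {n} (x : Fin (suc n)) (v : Vec (Fin n) n) →
               #132 (prepend x v) ≡ Pattern132.#lead (prepend x v) + #132 v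
#132-prepend x v = trans (Pattern132.#occ-∷ x (Vec.map (punchIn x) v))
  (cong (Pattern132.#lead (prepend x v) +_) (Pattern132.#occ-map-punchIn R132-invariant x v))

#123-prepend : ∀ {n} (x : Fin (suc n)) (v : Vec (Fin n) n) →
               #123 (prepend x v) ≡ Pattern123.#lead (prepend x v) + #123 v
#123-prepend x v = trans (Pattern123.#occ-∷ x (Vec.map (punchIn x) v))
  (cong (Pattern123.#lead (prepend x v) +_) (Pattern123.#occ-map-punchIn R123-invariant x v))

-- A letter a of v becomes punchIn x a in prepend x v, which exceeds x exactly when x ≤ a.
lead132⇔ : ∀ {n} (x : Fin (suc n)) (v : Vec (Fin n) n) j k →
           Occ132 (prepend x v) (zero , suc j , suc k) ⇔
           (j Fin.< k × toℕ x ≤ toℕ (lookup v k) × lookup v k Fin.< lookup v j)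
lead132⇔ x v j k rewrite lookup-map j (punchIn x) v | lookup-map k (punchIn x) v = mk⇔
  (λ (_ , j<k , x<vk , vk<vj) → s<s⁻¹ j<k , to (<punchIn⇔ x _) x<vk , to (punchIn-<⇔ x) vk<vj)
  (λ (j<k , x≤vk , vk<vj) → z<s , s<s j<k , from (<punchIn⇔ x _) x≤vk , from (punchIn-<⇔ x) vk<vj)

lead123⇔ : ∀ {n} (x : Fin (suc n)) (v : Vec (Fin n) n) j k →
           Occ123 (prepend x v) (zero , suc j , suc k) ⇔
           (j Fin.< k × toℕ x ≤ toℕ (lookup v j) × lookup v j Fin.< lookup v k)
lead123⇔ x v j k rewrite lookup-map j (punchIn x) v | lookup-map k (punchIn x) v = mk⇔
  (λ (_ , j<k , x<vj , vj<vk) → s<s⁻¹ j<k , to (<punchIn⇔ x _) x<vj , to (punchIn-<⇔ x) vj<vk)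
  (λ (j<k , x≤vj , vj<vk) → z<s , s<s j<k , from (<punchIn⇔ x _) x≤vj , from (punchIn-<⇔ x) vj<vk)

-- The first letter

-- Good and good? are PermWith 1 0 and permWith? 1 0, unfolded.
PermWith : ℕ → ℕ → ∀ {n} → Vec (Fin n) n → Set
PermWith c d w = IsPerm w × #132 w ≡ c × #123 w ≡ d

permWith? : ∀ c d {n} → Decidable (PermWith c d {n})
permWith? c d w = isPerm? w ×-dec (#132 w ℕ.≟ c) ×-dec (#123 w ℕ.≟ d)

StartsWithMax : ∀ {n} → Vec (Fin (suc n)) (suc n) → Set
StartsWithMax {n} w = lookup w zero ≡ fromℕ n

startsWithMax? : ∀ {n} → Decidable (StartsWithMax {n})
startsWithMax? {n} w = lookup w zero Finₚ.≟ fromℕ n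

squeeze : ∀ {k a b : ℕ} → k ≤ a → a < b → b < 2 + k → a ≡ k × b ≡ suc k
squeeze {k} {a} {b} k≤a a<b b<2+k = a≡k , ℕ.≤-antisym (ℕ.≤-pred b<2+k) (subst (_< _) a≡k a<b)
  where
  a≡k : a ≡ k
  a≡k = ℕ.≤-antisym (ℕ.≤-pred (ℕ.≤-trans a<b (ℕ.≤-pred b<2+k))) k≤a

module FirstLetter {n} (x : Fin (suc n)) (v : Vec (Fin n) n) where

  lead132? : Decidable₂ λ j k → Occ132 (prepend x v) (zero , suc j , suc k)
  lead132? = Pattern132.lead? (prepend x v)

  lead123? : Decidable₂ λ j k → Occ123 (prepend x v) (zero , suc j , suc k)
  lead123? = Pattern123.lead? (prepend x v)

  #lead132 : ℕ
  #lead132 = #pairs lead132?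

  #lead123 : ℕ
  #lead123 = #pairs lead123?

  permWith-prepend⇒ : ∀ {c d} → PermWith c d (prepend x v) →
                      IsPerm v × #lead132 + #132 v ≡ c × #lead123 + #123 v ≡ d
  permWith-prepend⇒ (perm , e132 , e123) =
    to (isPerm-prepend x v) perm , trans (sym (#132-prepend x v)) e132 , trans (sym (#123-prepend x v)) e123

  lead123-at : ∀ {j k} → j Fin.< k → toℕ x ≤ toℕ (lookup v j) → lookup v j Fin.< lookup v k →
               1 ≤ #lead123
  lead123-at j<k x≤vj vj<vk = 1≤#pairs lead123? (from (lead123⇔ x v _ _) (j<k , x≤vj , vj<vk))

  leads-vanish : n ≤ suc (toℕ x) → #lead132 ≡ 0 × #lead123 ≡ 0
  leads-vanish n≤1+x =
      #pairs≡0 lead132? (λ j k o → let _ , x≤vk , vk<vj = to (lead132⇔ x v j k) o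
                                   in  no-value-above (ℕ.≤-<-trans x≤vk vk<vj))
    , #pairs≡0 lead123? (λ j k o → let _ , x≤vj , vj<vk = to (lead123⇔ x v j k) o
                                   in  no-value-above (ℕ.≤-<-trans x≤vj vj<vk))
    where
    no-value-above : ∀ {i} → ¬ (toℕ x < toℕ (lookup v i))
    no-value-above {i} x<vi = ℕ.<⇒≱ x<vi (ℕ.≤-pred (ℕ.≤-trans (Finₚ.toℕ<n (lookup v i)) n≤1+x))

  prepend-high⇔ : n ≤ suc (toℕ x) → ∀ {c d} → PermWith c d (prepend x v) ⇔ PermWith c d v
  prepend-high⇔ n≤1+x = isPerm-prepend x v
                    ×-⇔ dropLead (#132-prepend x v) (proj₁ (leads-vanish n≤1+x))
                    ×-⇔ dropLead (#123-prepend x v) (proj₂ (leads-vanish n≤1+x))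
    where
    dropLead : ∀ {a l b c} → a ≡ l + b → l ≡ 0 → (a ≡ c) ⇔ (b ≡ c)
    dropLead a≡l+b l≡0 = let a≡b = trans a≡l+b (cong (_+ _) l≡0) in mk⇔ (trans (sym a≡b)) (trans a≡b)

  no-lead123⇒decreasing : #lead123 ≡ 0 → ∀ {p q} →
                          toℕ x ≤ toℕ (lookup v p) → lookup v p Fin.< lookup v q → q Fin.< p
  no-lead123⇒decreasing none {p} {q} x≤vp vp<vq with Finₚ.<-cmp p q
  ... | tri< p<q _ _  = contradiction none (ℕ.m<n⇒n≢0 (lead123-at p<q x≤vp vp<vq))
  ... | tri≈ _ refl _ = contradiction vp<vq (ℕ.<-irrefl refl)
  ... | tri> _ _ q<p  = q<p

  module AboveFirst (perm : IsPerm v) {r} (r+x≤n : r + toℕ x ≤ n) where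

    private
      located : ∀ (i : Fin r) → ∃ λ p → toℕ (lookup v p) ≡ toℕ i + toℕ x
      located i = position v perm (ℕ.≤-trans (ℕ.+-monoˡ-< (toℕ x) (Finₚ.toℕ<n i)) r+x≤n)

    pos : Fin r → Fin n
    pos i = proj₁ (located i)

    x≤pos : ∀ i → toℕ x ≤ toℕ (lookup v (pos i))
    x≤pos i = subst (toℕ x ≤_) (sym (proj₂ (located i))) (ℕ.m≤n+m (toℕ x) (toℕ i))

    pos-< : ∀ {i j} → i Fin.< j → lookup v (pos i) Fin.< lookup v (pos j)
    pos-< {i} {j} i<j =
      subst₂ _<_ (sym (proj₂ (located i))) (sym (proj₂ (located j))) (ℕ.+-monoˡ-< (toℕ x) i<j)

  ¬avoids-low : 2 + toℕ x ≤ n → ¬ PermWith 0 0 (prepend x v)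
  ¬avoids-low 2+x≤n w∈ with permWith-prepend⇒ w∈
  ... | perm , e132 , e123 = ℕ.m<n⇒n≢0 (1≤#pairs lead132? lead) (ℕ.m+n≡0⇒m≡0 _ e132)
    where
    open AboveFirst perm 2+x≤n
    lead : Occ132 (prepend x v) (zero , suc (pos 1F) , suc (pos 0F))
    lead = from (lead132⇔ x v (pos 1F) (pos 0F))
      (no-lead123⇒decreasing (ℕ.m+n≡0⇒m≡0 _ e123) (x≤pos 0F) (pos-< z<s) , x≤pos 0F , pos-< z<s)

  ¬good-low : 3 + toℕ x ≤ n → ¬ PermWith 1 0 (prepend x v)
  ¬good-low 3+x≤n w∈ with permWith-prepend⇒ w∈
  ... | perm , e132 , e123 =
    ℕ.<⇒≱ (2≤#pairs lead132? lead₁ lead₀ pos₁≢pos₀) (ℕ.m+n≤o⇒m≤o _ (ℕ.≤-reflexive e132))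
    where
    open AboveFirst perm 3+x≤n
    decreasing : ∀ {p q} → toℕ x ≤ toℕ (lookup v p) → lookup v p Fin.< lookup v q → q Fin.< p
    decreasing = no-lead123⇒decreasing (ℕ.m+n≡0⇒m≡0 _ e123)
    lead₁ : Occ132 (prepend x v) (zero , suc (pos 2F) , suc (pos 1F))
    lead₁ = from (lead132⇔ x v (pos 2F) (pos 1F))
      (decreasing (x≤pos 1F) (pos-< (s<s z<s)) , x≤pos 1F , pos-< (s<s z<s))
    lead₀ : Occ132 (prepend x v) (zero , suc (pos 2F) , suc (pos 0F))
    lead₀ = from (lead132⇔ x v (pos 2F) (pos 0F))
      (decreasing (x≤pos 0F) (pos-< z<s) , x≤pos 0F , pos-< z<s)
    pos₁≢pos₀ : pos 1F ≢ pos 0F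
    pos₁≢pos₀ eq = Finₚ.<⇒≢ (pos-< z<s) (cong (lookup v) (sym eq))

module ThirdLargestFirst {k} (x : Fin (3 + k)) (v : Vec (Fin (2 + k)) (2 + k)) (x≡k : toℕ x ≡ k) where

  open FirstLetter x v

  module Top (perm : IsPerm v) where

    private
      located₀ : ∃ λ p → toℕ (lookup v p) ≡ k
      located₀ = position v perm (ℕ.m<n+m k z<s)

      located₁ : ∃ λ p → toℕ (lookup v p) ≡ suc k
      located₁ = position v perm (ℕ.n<1+n (suc k))

    q₀ q₁ : Fin (2 + k)
    q₀ = proj₁ located₀
    q₁ = proj₁ located₁

    value-q₀ : toℕ (lookup v q₀) ≡ k
    value-q₀ = proj₂ located₀

    value-q₁ : toℕ (lookup v q₁) ≡ suc k
    value-q₁ = proj₂ located₁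

    x≤q₀ : toℕ x ≤ toℕ (lookup v q₀)
    x≤q₀ = ℕ.≤-reflexive (trans x≡k (sym value-q₀))

    vq₀<vq₁ : lookup v q₀ Fin.< lookup v q₁
    vq₀<vq₁ = subst₂ _<_ (sym value-q₀) (sym value-q₁) (ℕ.n<1+n k)

    at-q₀ : ∀ {i} → toℕ (lookup v i) ≡ k → i ≡ q₀
    at-q₀ e = perm _ _ (Finₚ.toℕ-injective (trans e (sym value-q₀)))

    at-q₁ : ∀ {i} → toℕ (lookup v i) ≡ suc k → i ≡ q₁
    at-q₁ e = perm _ _ (Finₚ.toℕ-injective (trans e (sym value-q₁)))

    increasing-above-x : ∀ {a b} → toℕ x ≤ toℕ (lookup v a) → lookup v a Fin.< lookup v b →
                         a ≡ q₀ × b ≡ q₁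
    increasing-above-x {a} {b} x≤va va<vb =
      let va≡k , vb≡1+k = squeeze (subst (_≤ _) x≡k x≤va) va<vb (Finₚ.toℕ<n (lookup v b))
      in  at-q₀ va≡k , at-q₁ vb≡1+k

    lead132≡1 : q₁ Fin.< q₀ → #lead132 ≡ 1
    lead132≡1 q₁<q₀ =
      #pairs≡1 lead132? (from (lead132⇔ x v q₁ q₀) (q₁<q₀ , x≤q₀ , vq₀<vq₁)) λ o →
      let _ , x≤vk , vk<vj = to (lead132⇔ x v _ _) o
      in  swap (increasing-above-x x≤vk vk<vj)

    lead123≡0 : q₁ Fin.< q₀ → #lead123 ≡ 0
    lead123≡0 q₁<q₀ = #pairs≡0 lead123? λ j k′ o →
      let j<k′ , x≤vj , vj<vk′ = to (lead123⇔ x v j k′) o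
          j≡q₀ , k′≡q₁ = increasing-above-x x≤vj vj<vk′
      in  Finₚ.<-asym q₁<q₀ (subst₂ Fin._<_ j≡q₀ k′≡q₁ j<k′)

    head-is-max : #132 v ≡ 0 → q₁ Fin.< q₀ → StartsWithMax v
    head-is-max no132 q₁<q₀ with ℕ.<-cmp (toℕ (lookup v zero)) k
    ... | tri< v0<k _ _ = contradiction no132 (ℕ.m<n⇒n≢0 (Pattern132.1≤#occ v occ))
      where
      0≢q₁ : zero ≢ q₁
      0≢q₁ 0≡q₁ = ℕ.<⇒≱ v0<k
        (ℕ.≤-trans (ℕ.n≤1+n k) (ℕ.≤-reflexive (sym (trans (cong (toℕ ∘ lookup v) 0≡q₁) value-q₁))))
      occ : Occ132 v (zero , q₁ , q₀)
      occ = Finₚ.≤∧≢⇒< z≤n 0≢q₁ , q₁<q₀ , subst (_ <_) (sym value-q₀) v0<k , vq₀<vq₁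
    ... | tri≈ _ v0≡k _ = contradiction (subst (q₁ Fin.<_) (sym (at-q₀ v0≡k)) q₁<q₀) λ ()
    ... | tri> _ _ k<v0 = Finₚ.toℕ-injective
      (trans (ℕ.≤-antisym (ℕ.≤-pred (Finₚ.toℕ<n (lookup v zero))) k<v0) (sym (Finₚ.toℕ-fromℕ (suc k))))

  good⇔ : PermWith 1 0 (prepend x v) ⇔ (PermWith 0 0 v × StartsWithMax v)
  good⇔ = mk⇔ to′ from′
    where
    to′ : PermWith 1 0 (prepend x v) → PermWith 0 0 v × StartsWithMax v
    to′ w∈ with permWith-prepend⇒ w∈
    ... | perm , e132 , e123 = (perm , no132 , ℕ.m+n≡0⇒n≡0 _ e123) , head-is-max no132 q₁<q₀
      where
      open Top perm
      q₁<q₀ : q₁ Fin.< q₀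
      q₁<q₀ = no-lead123⇒decreasing (ℕ.m+n≡0⇒m≡0 _ e123) x≤q₀ vq₀<vq₁
      no132 : #132 v ≡ 0
      no132 = ℕ.suc-injective (trans (cong (_+ #132 v) (sym (lead132≡1 q₁<q₀))) e132)

    from′ : PermWith 0 0 v × StartsWithMax v → PermWith 1 0 (prepend x v)
    from′ ((perm , no132 , no123) , head≡max) = from (isPerm-prepend x v) perm
      , trans (#132-prepend x v) (cong₂ _+_ (lead132≡1 q₁<q₀) no132)
      , trans (#123-prepend x v) (cong₂ _+_ (lead123≡0 q₁<q₀) no123)
      where
      open Top perm
      q₁≡0 : q₁ ≡ zero
      q₁≡0 = sym (at-q₁ (trans (cong toℕ head≡max) (Finₚ.toℕ-fromℕ (suc k))))
      0≢q₀ : zero ≢ q₀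
      0≢q₀ 0≡q₀ =
        ℕ.1+n≢n (trans (sym value-q₁) (trans (cong (toℕ ∘ lookup v) (trans q₁≡0 0≡q₀)) value-q₀))
      q₁<q₀ : q₁ Fin.< q₀
      q₁<q₀ = subst (Fin._< q₀) (sym q₁≡0) (Finₚ.≤∧≢⇒< z≤n 0≢q₀)

-- Recurrences

toℕ-opposite+toℕ : ∀ {n} (y : Fin (suc n)) → toℕ (opposite y) + toℕ y ≡ n
toℕ-opposite+toℕ {n} y =
  trans (cong (_+ toℕ y) (Finₚ.opposite-prop y)) (ℕ.m∸n+n≡m (ℕ.≤-pred (Finₚ.toℕ<n y)))

opposite-near-top : ∀ {n} (y : Fin (suc n)) → toℕ y ≤ 1 → n ≤ suc (toℕ (opposite y))
opposite-near-top {n} y y≤1 = begin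
  n                         ≡⟨ toℕ-opposite+toℕ y ⟨
  toℕ (opposite y) + toℕ y  ≤⟨ ℕ.+-monoʳ-≤ (toℕ (opposite y)) y≤1 ⟩
  toℕ (opposite y) + 1      ≡⟨ ℕ.+-comm (toℕ (opposite y)) 1 ⟩
  suc (toℕ (opposite y))    ∎
  where open ℕ.≤-Reasoning

opposite-below-top : ∀ {n} e (y : Fin (suc n)) → e ≤ toℕ y → e + toℕ (opposite y) ≤ n
opposite-below-top {n} e y e≤y = begin
  e + toℕ (opposite y)      ≤⟨ ℕ.+-monoˡ-≤ (toℕ (opposite y)) e≤y ⟩
  toℕ y + toℕ (opposite y)  ≡⟨ ℕ.+-comm (toℕ y) (toℕ (opposite y)) ⟩
  toℕ (opposite y) + toℕ y  ≡⟨ toℕ-opposite+toℕ y ⟩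
  n                         ∎
  where open ℕ.≤-Reasoning

#avoiders : ℕ → ℕ
#avoiders n = #words n (permWith? 0 0 {n})

#avoiders-starting-with-max : ∀ n → #words (suc n) (λ w → permWith? 0 0 w ×-dec startsWithMax? w) ≡ #avoiders n
#avoiders-starting-with-max n = begin
  #words (suc n) P?
    ≡⟨ #perms-by-first n P? (λ _ → proj₁ ∘ proj₁) ⟩
  sum (λ x → #words n (λ v → P? (prepend x v)))
    ≡⟨ sum-single _ (fromℕ n) (λ x x≢max →
         #words-none n (λ v → P? (prepend x v)) λ _ → x≢max ∘ proj₂) ⟩
  #words n (λ v → P? (prepend (fromℕ n) v))
    ≡⟨ #words-cong n (λ v → P? (prepend (fromℕ n) v)) (permWith? 0 0)
         (λ v → mk⇔ (to (top⇔ v) ∘ proj₁) (λ v∈ → from (top⇔ v) v∈ , refl)) ⟩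
  #avoiders n
    ∎
  where
  open ≡-Reasoning
  P? : Decidable λ w → PermWith 0 0 w × StartsWithMax w
  P? w = permWith? 0 0 w ×-dec startsWithMax? w
  top⇔ : ∀ v → PermWith 0 0 (prepend (fromℕ n) v) ⇔ PermWith 0 0 v
  top⇔ v = FirstLetter.prepend-high⇔ (fromℕ n) v
    (subst (λ t → n ≤ suc t) (sym (Finₚ.toℕ-fromℕ n)) (ℕ.n≤1+n n))

#avoiders-suc : ∀ m → #avoiders (2 + m) ≡ 2 * #avoiders (1 + m)
#avoiders-suc m = begin
  #avoiders (2 + m)
    ≡⟨ #perms-by-first (1 + m) (permWith? 0 0) (λ _ → proj₁) ⟩
  sum F
    ≡⟨ sum-opposite F ⟩
  F (opposite 0F) + (F (opposite 1F) + sum (λ z → F (opposite (suc (suc z)))))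
    ≡⟨ cong₂ _+_ (among-two-largest 0F z≤n)
         (cong₂ _+_ (among-two-largest 1F (s≤s z≤n)) (sum-zero _ lower)) ⟩
  #avoiders (1 + m) + (#avoiders (1 + m) + 0)
    ∎
  where
  open ≡-Reasoning
  F : Fin (2 + m) → ℕ
  F x = #words (1 + m) (λ v → permWith? 0 0 (prepend x v))
  among-two-largest : ∀ y → toℕ y ≤ 1 → F (opposite y) ≡ #avoiders (1 + m)
  among-two-largest y y≤1 = #words-cong (1 + m) (λ v → permWith? 0 0 (prepend (opposite y) v)) (permWith? 0 0)
    λ v → FirstLetter.prepend-high⇔ (opposite y) v (opposite-near-top y y≤1)
  lower : ∀ z → F (opposite (suc (suc z))) ≡ 0
  lower z = #words-none (1 + m) (λ v → permWith? 0 0 (prepend (opposite (suc (suc z))) v))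
    λ v → FirstLetter.¬avoids-low (opposite (suc (suc z))) v
            (opposite-below-top 2 (suc (suc z)) (s≤s (s≤s z≤n)))

#good-suc : ∀ m → count (3 + m) ≡ count (2 + m) + (count (2 + m) + (#avoiders (1 + m) + 0))
#good-suc m = begin
  count (3 + m)
    ≡⟨ #perms-by-first (2 + m) (permWith? 1 0) (λ _ → proj₁) ⟩
  sum F
    ≡⟨ sum-opposite F ⟩
  F (opposite 0F) + (F (opposite 1F) + (F (opposite 2F) + sum (λ z → F (opposite (suc (suc (suc z)))))))
    ≡⟨ cong₂ _+_ (among-two-largest 0F z≤n)
         (cong₂ _+_ (among-two-largest 1F (s≤s z≤n)) (cong₂ _+_ third-largest (sum-zero _ lower))) ⟩
  count (2 + m) + (count (2 + m) + (#avoiders (1 + m) + 0))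
    ∎
  where
  open ≡-Reasoning
  F : Fin (3 + m) → ℕ
  F x = #words (2 + m) (λ v → permWith? 1 0 (prepend x v))
  among-two-largest : ∀ y → toℕ y ≤ 1 → F (opposite y) ≡ count (2 + m)
  among-two-largest y y≤1 = #words-cong (2 + m) (λ v → permWith? 1 0 (prepend (opposite y) v)) (permWith? 1 0)
    λ v → FirstLetter.prepend-high⇔ (opposite y) v (opposite-near-top y y≤1)
  third-largest : F (opposite 2F) ≡ #avoiders (1 + m)
  third-largest = trans
    (#words-cong (2 + m) (λ v → permWith? 1 0 (prepend (opposite 2F) v)) _
      λ v → ThirdLargestFirst.good⇔ (opposite 2F) v
              (ℕ.+-cancelʳ-≡ 2 _ m (trans (toℕ-opposite+toℕ 2F) (ℕ.+-comm 2 m))))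
    (#avoiders-starting-with-max (1 + m))
  lower : ∀ z → F (opposite (suc (suc (suc z)))) ≡ 0
  lower z = #words-none (2 + m) (λ v → permWith? 1 0 (prepend (opposite (suc (suc (suc z)))) v))
    λ v → FirstLetter.¬good-low (opposite (suc (suc (suc z)))) v
            (opposite-below-top 3 (suc (suc (suc z))) (s≤s (s≤s (s≤s z≤n))))

#avoiders-closed : ∀ m → #avoiders (suc m) ≡ 2 ^ m
#avoiders-closed zero    = refl
#avoiders-closed (suc m) = trans (#avoiders-suc m) (cong (2 *_) (#avoiders-closed m))

count-closed : ∀ m → count (3 + m) ≡ suc m * 2 ^ m
count-closed zero    = refl
count-closed (suc m) = begin
  count (4 + m)
    ≡⟨ #good-suc (suc m) ⟩
  count (3 + m) + (count (3 + m) + (#avoiders (2 + m) + 0))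
    ≡⟨ cong₂ (λ c a → c + (c + (a + 0))) (count-closed m) (#avoiders-closed (suc m)) ⟩
  suc m * 2 ^ m + (suc m * 2 ^ m + (2 * 2 ^ m + 0))
    ≡⟨ arithmetic m (2 ^ m) ⟩
  suc (suc m) * 2 ^ suc m
    ∎
  where
  open ≡-Reasoning
  arithmetic : ∀ m p → suc m * p + (suc m * p + (2 * p + 0)) ≡ suc (suc m) * (2 * p)
  arithmetic = solve-∀

theorem2 : ∀ (n : ℕ) → 3 ≤ n → count n ≡ (n ∸ 2) * 2 ^ (n ∸ 3)
theorem2 (suc (suc (suc m))) (s≤s (s≤s (s≤s _))) = count-closed m
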